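{- Let $a(n)=|D_{[n]}(A_n)|$ for $n\ge 1$. Then $a(n)$ is odd if and only if $n=1$ or $n=2^t$ for some integer $t>1$.
   Context: The set of alternatives is $[n]=\{1,\dots,n\}$ with its natural order. For a triple $i<j<k$, the never condition $1N3$ on a set of linear orders means that in every order, $i$ is not ranked last among $i,j,k$; $3N1$ means that $k$ is not ranked first among $i,j,k$. For $B\subseteq[n]$, $D_{[n]}(B)$ is the set of all linear orders on $[n]$ such that every triple $i<j<k$ satisfies $1N3$ if $j\in B$ and $3N1$ if $j\notin B$. The even $1N33N1$-alternating scheme uses $A_n=\{2,4,6,\dots,n-2+p_n\}$ where $p_n=n\bmod 2$, i.e. the even numbers up to $n-2$ for even $n$ and up to $n-1$ for odd $n$ (empty for small $n$). -}

module Defs where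

open import Data.Nat using (ℕ; zero; suc; _+_; _∸_; _≡ᵇ_; _<ᵇ_; _%_)
open import Data.Bool using (Bool; true; false; if_then_else_; _∧_; _∨_; not)
open import Data.List using (List; []; _∷_; map; concatMap; filter; length)
open import Data.Bool.ListAction using (and)
open import Data.List.Base using (upTo)
open import Relation.Nullary.Decidable using (yes; no)
open import Data.Bool using (T?)

alts : ℕ → List ℕ
alts n = map suc (upTo n)

-- A linear order on [n] is represented by its ranking list (first = ranked
-- highest), i.e. a permutation of alts n.  We enumerate all of them.
insertions : ℕ → List ℕ → List (List ℕ)
insertions x [] = (x ∷ []) ∷ []
insertions x (y ∷ ys) = (x ∷ y ∷ ys) ∷ map (y ∷_) (insertions x ys)

perms : List ℕ → List (List ℕ)
perms [] = [] ∷ []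
perms (x ∷ xs) = concatMap (insertions x) (perms xs)

linearOrders : ℕ → List (List ℕ)
linearOrders n = perms (alts n)

allB : (ℕ → Bool) → List ℕ → Bool
allB p xs = and (map p xs)

elem : ℕ → List ℕ → Bool
elem x [] = false
elem x (z ∷ zs) = (z ≡ᵇ x) ∨ elem x zs

above : ℕ → ℕ → List ℕ → Bool
above x y [] = false
above x y (z ∷ zs) =
  if z ≡ᵇ x then elem y zs else (if z ≡ᵇ y then false else above x y zs)

oneN3 : List ℕ → ℕ → ℕ → ℕ → Bool
oneN3 σ i j k = not (above j i σ ∧ above k i σ)

threeN1 : List ℕ → ℕ → ℕ → ℕ → Bool
threeN1 σ i j k = not (above k i σ ∧ above k j σ)

inDomain : ℕ → (ℕ → Bool) → List ℕ → Bool
inDomain n B σ =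
  allB (λ i → allB (λ j → allB (λ k →
      if (i <ᵇ j) ∧ (j <ᵇ k)
      then (if B j then oneN3 σ i j k else threeN1 σ i j k)
      else true) (alts n)) (alts n)) (alts n)

D : ℕ → (ℕ → Bool) → List (List ℕ)
D n B = filter (λ σ → T? (inDomain n B σ)) (linearOrders n)

-- A_n = {2,4,…, n-2+p_n}, p_n = n mod 2.
A : ℕ → ℕ → Bool
A n j = (j % 2 ≡ᵇ 0) ∧ (1 <ᵇ j) ∧ (j <ᵇ suc ((n ∸ 2) + n % 2))

a : ℕ → ℕ
a n = length (D n (A n))

-- Build a ranking of [n] by inserting n, n - 1, ..., 1 in turn, each new element lying below
-- all present ones in the natural order.  For a ranking σ in the domain, the positions
-- (0 = top) where the next element m may go are exactly 0, ..., threshold σ, and inserting it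
-- at position p leaves the threshold nextThreshold (B m) p (threshold σ); this gives the
-- recursion completions for a(n).  For A_n, writing alternating i t for the completions by
-- 2i + 1, ..., 1, it reads alternating (i + 1) t = (t + 1) alternating i 1 + Σ_{p=1}^{t+1}
-- alternating i p.  The hockey-stick identity and (1 + X)^(2^j) ≡ 1 + X^(2^j) (mod 2) then give
-- alternating (r + 2^j) t ≡ C(t + 2r + 1, r + 2^j + 1) (mod 2) for r < 2^j.  Hence
-- a(2i + 4) = alternating (i + 1) 1 is odd iff i + 2 is a power of two, while
-- a(2k + 3) = 2 · alternating k 1 is even.

module Submission where

open import Defs
open import Data.Bool using (Bool; true; false; if_then_else_; _∧_; not; _xor_; T)
open import Data.Bool.Properties
  using (T-≡; T-∧; ∧-identityʳ; ∧-zeroʳ; ∨-zeroʳ; if-cong₂; xor-same; xor-identityʳ; xor-comm; xor-assoc)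
open import Data.Empty using (⊥-elim)
open import Data.List
  using (List; []; _∷_; _++_; map; length; filter; concatMap; applyUpTo; cartesianProductWith)
open import Data.List.Extrema.Nat using (min; min≤⊤; min≤xs; v≤min⁺)
open import Data.List.Membership.Propositional using (_∈_)
open import Data.List.Membership.Propositional.Properties
  using (∈-cartesianProductWith⁺; ∈-cartesianProductWith⁻)
open import Data.List.Properties using (map-++; map-∘; map-applyUpTo)
open import Data.List.Relation.Unary.All as All using (All; []; _∷_)
open import Data.List.Relation.Unary.All.Properties using (all⁺; all⁻; concat⁺; map⁺)
open import Data.List.Relation.Unary.Any using (here; there)
open import Data.Nat
open import Data.Nat.Combinatorics using (_C_; nCk+nC[k+1]≡[n+1]C[k+1]; k>n⇒nCk≡0; nCn≡1; nC1≡n)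
open import Data.Nat.ListAction using (sum)
open import Data.Nat.ListAction.Properties using (sum-++)
open import Data.Nat.Properties
open import Data.Product using (∃-syntax; _×_; _,_; proj₁; proj₂)
open import Data.Sum using (_⊎_; inj₁; inj₂)
open import Function using (_∘_; _$_; id; case_of_)
open import Function.Bundles using (_⇔_; mk⇔; Equivalence)
open import Function.Properties.Equivalence using (⇔-setoid) renaming (trans to ⇔-trans; sym to ⇔-sym)
open import Level using (0ℓ)
open import Relation.Binary.Definitions using (tri<; tri≈; tri>)
open import Relation.Binary.PropositionalEquality
import Relation.Binary.Reasoning.Setoid as SetoidReasoning
open import Relation.Nullary using (¬_; contradiction; yes; no)
open import Relation.Nullary.Decidable using (T?)
open import Relation.Nullary.Reflects using (ofʸ; ofⁿ)

Bool-ext : ∀ {b c : Bool} → (T b → T c) → (T c → T b) → b ≡ c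
Bool-ext {false} {false} _ _ = refl
Bool-ext {false} {true}  _ g = ⊥-elim (g _)
Bool-ext {true}  {false} f _ = ⊥-elim (f _)
Bool-ext {true}  {true}  _ _ = refl

≡true-cong : ∀ {b c : Bool} → b ≡ c → (b ≡ true) ⇔ (c ≡ true)
≡true-cong b≡c = mk⇔ (trans (sym b≡c)) (trans b≡c)

false⇔ : ∀ {b : Bool} {P : Set} → b ≡ false → ¬ P → (b ≡ true) ⇔ P
false⇔ b≡false ¬P = mk⇔ (λ b≡true → contradiction (trans (sym b≡false) b≡true) λ ()) (⊥-elim ∘ ¬P)

≡ᵇ-refl : ∀ m → (m ≡ᵇ m) ≡ true
≡ᵇ-refl zero    = refl
≡ᵇ-refl (suc m) = ≡ᵇ-refl m

≢⇒≡ᵇ≡false : ∀ {m n} → m ≢ n → (m ≡ᵇ n) ≡ false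
≢⇒≡ᵇ≡false {zero}  {zero}  m≢n = contradiction refl m≢n
≢⇒≡ᵇ≡false {zero}  {suc n} _   = refl
≢⇒≡ᵇ≡false {suc m} {zero}  _   = refl
≢⇒≡ᵇ≡false {suc m} {suc n} m≢n = ≢⇒≡ᵇ≡false (m≢n ∘ cong suc)

<⇒<ᵇ≡true : ∀ {m n} → m < n → (m <ᵇ n) ≡ true
<⇒<ᵇ≡true m<n = Equivalence.to T-≡ (<⇒<ᵇ m<n)

≥⇒<ᵇ≡false : ∀ {m n} → n ≤ m → (m <ᵇ n) ≡ false
≥⇒<ᵇ≡false z≤n       = refl
≥⇒<ᵇ≡false (s≤s n≤m) = ≥⇒<ᵇ≡false n≤m

≤⇒≤ᵇ≡true : ∀ {m n} → m ≤ n → (m ≤ᵇ n) ≡ true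
≤⇒≤ᵇ≡true m≤n = Equivalence.to T-≡ (≤⇒≤ᵇ m≤n)

≤ᵇ≡<ᵇsuc : ∀ m n → (m ≤ᵇ n) ≡ (m <ᵇ suc n)
≤ᵇ≡<ᵇsuc zero    n = refl
≤ᵇ≡<ᵇsuc (suc m) n = refl

not-<ᵇ : ∀ m n → not (m <ᵇ n) ≡ (n ≤ᵇ m)
not-<ᵇ m       zero    = refl
not-<ᵇ zero    (suc n) = refl
not-<ᵇ (suc m) (suc n) = trans (not-<ᵇ m n) (≤ᵇ≡<ᵇsuc n m)

⊔-<ᵇ : ∀ m n p → (m ⊔ n <ᵇ p) ≡ (m <ᵇ p) ∧ (n <ᵇ p)
⊔-<ᵇ m       n       zero    = refl
⊔-<ᵇ zero    n       (suc p) = refl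
⊔-<ᵇ (suc m) zero    (suc p) = sym (∧-identityʳ (m <ᵇ p))
⊔-<ᵇ (suc m) (suc n) (suc p) = ⊔-<ᵇ m n p

≤-suc-pred : ∀ q → q ≤ suc (pred q)
≤-suc-pred zero    = z≤n
≤-suc-pred (suc q) = ≤-refl

xor-cancel-middle : ∀ a b c → (a xor b) xor (b xor c) ≡ a xor c
xor-cancel-middle a b c = begin
  (a xor b) xor (b xor c) ≡⟨ xor-assoc a b (b xor c) ⟩
  a xor (b xor (b xor c)) ≡⟨ cong (a xor_) (sym (xor-assoc b b c)) ⟩
  a xor ((b xor b) xor c) ≡⟨ cong (λ x → a xor (x xor c)) (xor-same b) ⟩
  a xor c                 ∎
  where open ≡-Reasoning

xor-cancel-outer : ∀ a b → a xor (b xor a) ≡ b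
xor-cancel-outer a b = begin
  a xor (b xor a) ≡⟨ cong (a xor_) (xor-comm b a) ⟩
  a xor (a xor b) ≡⟨ xor-assoc a a b ⟨
  (a xor a) xor b ≡⟨ cong (_xor b) (xor-same a) ⟩
  b               ∎
  where open ≡-Reasoning

position : ℕ → List ℕ → ℕ
position x []       = 0
position x (z ∷ zs) = if z ≡ᵇ x then 0 else suc (position x zs)

insertAt : ℕ → ℕ → List ℕ → List ℕ
insertAt zero    m σ        = m ∷ σ
insertAt (suc p) m []       = m ∷ []
insertAt (suc p) m (z ∷ zs) = z ∷ insertAt p m zs

shift : ℕ → ℕ → ℕ
shift p c = if c <ᵇ p then c else suc c

module _ {x : ℕ} where

  absent-below : ∀ {m σ} → x ≤ m → All (m <_) σ → All (_≢ x) σ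
  absent-below x≤m = All.map λ m<z z≡x → <⇒≱ m<z (subst (_≤ _) (sym z≡x) x≤m)

  elem-absent : ∀ {σ} → All (_≢ x) σ → elem x σ ≡ false
  elem-absent []            = refl
  elem-absent (z≢x ∷ x∉zs) rewrite ≢⇒≡ᵇ≡false z≢x = elem-absent x∉zs

  above-absentˡ : ∀ {y σ} → All (_≢ x) σ → above x y σ ≡ false
  above-absentˡ                []           = refl
  above-absentˡ {y} {z ∷ _} (z≢x ∷ x∉zs) rewrite ≢⇒≡ᵇ≡false z≢x with z ≡ᵇ y
  ... | true  = refl
  ... | false = above-absentˡ x∉zs

  above-absentʳ : ∀ {y σ} → All (_≢ x) σ → above y x σ ≡ false
  above-absentʳ                []           = refl
  above-absentʳ {y} {z ∷ _} (z≢x ∷ x∉zs) with z ≡ᵇ y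
  ... | true  = elem-absent x∉zs
  ... | false rewrite ≢⇒≡ᵇ≡false z≢x = above-absentʳ x∉zs

  position-absent : ∀ {σ} → All (_≢ x) σ → position x σ ≡ length σ
  position-absent []           = refl
  position-absent (z≢x ∷ x∉zs) rewrite ≢⇒≡ᵇ≡false z≢x = cong suc (position-absent x∉zs)

  position≤length : ∀ σ → position x σ ≤ length σ
  position≤length []       = z≤n
  position≤length (z ∷ zs) with z ≡ᵇ x
  ... | true  = z≤n
  ... | false = s≤s (position≤length zs)

module _ {m : ℕ} where

  length-insert : ∀ p σ → p ≤ length σ → length (insertAt p m σ) ≡ suc (length σ)
  length-insert zero    σ        _         = refl
  length-insert (suc p) (z ∷ zs) (s≤s p≤) = cong suc (length-insert p zs p≤)

  absent-insert : ∀ {x} p σ → x ≢ m → All (_≢ x) σ → All (_≢ x) (insertAt p m σ)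
  absent-insert zero    σ        x≢m x∉σ          = (x≢m ∘ sym) ∷ x∉σ
  absent-insert (suc p) []       x≢m []           = (x≢m ∘ sym) ∷ []
  absent-insert (suc p) (z ∷ zs) x≢m (z≢x ∷ x∉zs) = z≢x ∷ absent-insert p zs x≢m x∉zs

  elem-insert : ∀ p σ → elem m (insertAt p m σ) ≡ true
  elem-insert zero    σ        rewrite ≡ᵇ-refl m = refl
  elem-insert (suc p) []       rewrite ≡ᵇ-refl m = refl
  elem-insert (suc p) (z ∷ zs) rewrite elem-insert p zs = ∨-zeroʳ (z ≡ᵇ m)

  elem-insert-other : ∀ {y} p σ → y ≢ m → elem y (insertAt p m σ) ≡ elem y σ
  elem-insert-other zero    σ        y≢m rewrite ≢⇒≡ᵇ≡false (y≢m ∘ sym) = refl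
  elem-insert-other (suc p) []       y≢m rewrite ≢⇒≡ᵇ≡false (y≢m ∘ sym) = refl
  elem-insert-other (suc p) (z ∷ zs) y≢m rewrite elem-insert-other p zs y≢m = refl

  above-insert-other : ∀ {x y} p σ → x ≢ m → y ≢ m → above x y (insertAt p m σ) ≡ above x y σ
  above-insert-other zero    σ x≢m y≢m
    rewrite ≢⇒≡ᵇ≡false (x≢m ∘ sym) | ≢⇒≡ᵇ≡false (y≢m ∘ sym) = refl
  above-insert-other (suc p) [] x≢m y≢m
    rewrite ≢⇒≡ᵇ≡false (x≢m ∘ sym) | ≢⇒≡ᵇ≡false (y≢m ∘ sym) = refl
  above-insert-other {x} {y} (suc p) (z ∷ zs) x≢m y≢m with z ≡ᵇ x
  ... | true = elem-insert-other p zs y≢m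
  ... | false with z ≡ᵇ y
  ...   | true  = refl
  ...   | false = above-insert-other p zs x≢m y≢m

  above-insert : ∀ {x} p σ → x ≢ m → All (_≢ m) σ → p ≤ length σ →
                 above x m (insertAt p m σ) ≡ (position x σ <ᵇ p)
  above-insert zero σ x≢m _ _ rewrite ≢⇒≡ᵇ≡false (x≢m ∘ sym) | ≡ᵇ-refl m = refl
  above-insert {x} (suc p) (z ∷ zs) x≢m (z≢m ∷ m∉zs) (s≤s p≤) with z ≡ᵇ x
  ... | true  = elem-insert p zs
  ... | false rewrite ≢⇒≡ᵇ≡false z≢m = above-insert p zs x≢m m∉zs p≤

  position-insert-other : ∀ {x} p σ → x ≢ m → p ≤ length σ →
                          position x (insertAt p m σ) ≡ shift p (position x σ)
  position-insert-other zero σ x≢m _ rewrite ≢⇒≡ᵇ≡false (x≢m ∘ sym) = refl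
  position-insert-other {x} (suc p) (z ∷ zs) x≢m (s≤s p≤) with z ≡ᵇ x
  ... | true  = refl
  ... | false rewrite position-insert-other p zs x≢m p≤ with position x zs <ᵇ p
  ...   | true  = refl
  ...   | false = refl

  position-insert : ∀ p σ → All (_≢ m) σ → p ≤ length σ → position m (insertAt p m σ) ≡ p
  position-insert zero    σ        _            _        rewrite ≡ᵇ-refl m = refl
  position-insert (suc p) (z ∷ zs) (z≢m ∷ m∉zs) (s≤s p≤) rewrite ≢⇒≡ᵇ≡false z≢m =
    cong suc (position-insert p zs m∉zs p≤)

shift-≥ : ∀ {p c} → p ≤ c → shift p c ≡ suc c
shift-≥ p≤c rewrite ≥⇒<ᵇ≡false p≤c = refl

shift≤suc : ∀ p c → shift p c ≤ suc c
shift≤suc p c with c <ᵇ p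
... | true  = n≤1+n c
... | false = ≤-refl

shift-mono : ∀ p {c d} → c ≤ d → shift p c ≤ shift p d
shift-mono p {c} {d} c≤d with c <ᵇ p | <ᵇ-reflects-< c p | d <ᵇ p | <ᵇ-reflects-< d p
... | true  | _          | true  | _          = c≤d
... | true  | _          | false | _          = m≤n⇒m≤1+n c≤d
... | false | ofⁿ c≮p    | true  | ofʸ d<p    = contradiction (≤-<-trans c≤d d<p) c≮p
... | false | _          | false | _          = s≤s c≤d

shift-⊔ : ∀ p c d → shift p c ⊔ shift p d ≡ shift p (c ⊔ d)
shift-⊔ p c d with ≤-total c d
... | inj₁ c≤d rewrite m≤n⇒m⊔n≡n c≤d = m≤n⇒m⊔n≡n (shift-mono p c≤d)
... | inj₂ d≤c rewrite m≥n⇒m⊔n≡m d≤c = m≥n⇒m⊔n≡m (shift-mono p d≤c)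

-- Inserting a new smallest element into a ranking

nextThreshold : Bool → ℕ → ℕ → ℕ
nextThreshold true  zero    t = 1
nextThreshold true  (suc p) t = suc p
nextThreshold false zero    t = suc t
nextThreshold false (suc p) t = 0

nextThreshold≤suc : ∀ b {p t} → p ≤ t → nextThreshold b p t ≤ suc t
nextThreshold≤suc true  {zero}  _   = s≤s z≤n
nextThreshold≤suc true  {suc p} p≤t = m≤n⇒m≤1+n p≤t
nextThreshold≤suc false {zero}  _   = ≤-refl
nextThreshold≤suc false {suc p} _   = z≤n

ordered-cong : ∀ i j k {x y : Bool} → (i < j → j < k → x ≡ y) →
               (if (i <ᵇ j) ∧ (j <ᵇ k) then x else true) ≡ (if (i <ᵇ j) ∧ (j <ᵇ k) then y else true)
ordered-cong i j k x≡y with i <ᵇ j | <ᵇ-reflects-< i j | j <ᵇ k | <ᵇ-reflects-< j k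
... | true  | ofʸ i<j | true  | ofʸ j<k = x≡y i<j j<k
... | true  | _       | false | _       = refl
... | false | _       | _     | _       = refl

module Insertion (n : ℕ) (B : ℕ → Bool) where

  respects : List ℕ → ℕ → ℕ → ℕ → Bool
  respects σ i j k =
    if (i <ᵇ j) ∧ (j <ᵇ k) then (if B j then oneN3 σ i j k else threeN1 σ i j k) else true

  inDomain⇒respects : ∀ σ {i j k} → T (inDomain n B σ) →
                   i ∈ alts n → j ∈ alts n → k ∈ alts n → T (respects σ i j k)
  inDomain⇒respects σ valid i∈ j∈ k∈ =
    All.lookup (all⁺ _ _ (All.lookup (all⁺ _ _ (All.lookup (all⁺ _ _ valid) i∈)) j∈)) k∈

  respects⇒inDomain : ∀ σ → (∀ {i j k} → i ∈ alts n → j ∈ alts n → k ∈ alts n → T (respects σ i j k)) →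
                   T (inDomain n B σ)
  respects⇒inDomain σ ok = all⁻ _ $ All.tabulate λ i∈ → all⁻ _ $ All.tabulate λ j∈ →
                      all⁻ _ $ All.tabulate λ k∈ → ok i∈ j∈ k∈

  -- An element below j and k inserted at position p (0 = top) keeps the condition on this
  -- triple iff p ≤ bound σ j k.
  bound : List ℕ → ℕ → ℕ → ℕ
  bound σ j k = if j <ᵇ k
    then (if B j then position j σ ⊔ position k σ
          else (if above k j σ then position k σ else length σ))
    else length σ

  bounds : List ℕ → List ℕ
  bounds σ = cartesianProductWith (bound σ) (alts n) (alts n)

  threshold : List ℕ → ℕ
  threshold σ = min (length σ) (bounds σ)

  threshold≤length : ∀ σ → threshold σ ≤ length σ
  threshold≤length σ = min≤⊤ (length σ) (bounds σ)

  threshold≤bound : ∀ σ {j k} → j ∈ alts n → k ∈ alts n → threshold σ ≤ bound σ j k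
  threshold≤bound σ j∈ k∈ =
    All.lookup (min≤xs (length σ) (bounds σ)) (∈-cartesianProductWith⁺ (bound σ) j∈ k∈)

  ≤-threshold : ∀ σ {q} → q ≤ length σ → (∀ {j k} → j ∈ alts n → k ∈ alts n → q ≤ bound σ j k) →
                q ≤ threshold σ
  ≤-threshold σ q≤len q≤bound = v≤min⁺ q≤len $ All.tabulate λ v∈ →
    case ∈-cartesianProductWith⁻ (bound σ) (alts n) (alts n) v∈ of λ where
      (_ , _ , j∈ , k∈ , refl) → q≤bound j∈ k∈

  respects-absent : ∀ σ {i} j k → All (_≢ i) σ → respects σ i j k ≡ true
  respects-absent σ {i} j k i∉σ
    rewrite above-absentʳ {y = j} i∉σ | above-absentʳ {y = k} i∉σ
    with (i <ᵇ j) ∧ (j <ᵇ k) | B j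
  ... | false | _     = refl
  ... | true  | true  = refl
  ... | true  | false = refl

  respects-insert-other : ∀ p m σ i j k → i ≢ m → All (m <_) σ →
                          respects (insertAt p m σ) i j k ≡ respects σ i j k
  respects-insert-other p m σ i j k i≢m m<σ with <-cmp i m
  ... | tri≈ _ i≡m _ = contradiction i≡m i≢m
  ... | tri< i<m _ _ =
    trans (respects-absent _ j k (absent-insert p σ i≢m i∉σ)) (sym (respects-absent σ j k i∉σ))
    where i∉σ = absent-below (<⇒≤ i<m) m<σ
  ... | tri> _ _ m<i = ordered-cong i j k λ i<j j<k →
    let j≢m = >⇒≢ (<-trans m<i i<j)
        k≢m = >⇒≢ (<-trans (<-trans m<i i<j) j<k)
    in if-cong₂ (B j)
         (cong₂ (λ u v → not (u ∧ v)) (above-insert-other p σ j≢m i≢m) (above-insert-other p σ k≢m i≢m))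
         (cong₂ (λ u v → not (u ∧ v)) (above-insert-other p σ k≢m i≢m) (above-insert-other p σ k≢m j≢m))

  bound-absent : ∀ σ j k → All (_≢ j) σ ⊎ All (_≢ k) σ → bound σ j k ≡ length σ
  bound-absent σ j k absent with j <ᵇ k
  ... | false = refl
  ... | true with B j | absent
  ...   | true  | inj₁ j∉σ rewrite position-absent j∉σ = m≥n⇒m⊔n≡m (position≤length σ)
  ...   | true  | inj₂ k∉σ rewrite position-absent k∉σ = m≤n⇒m⊔n≡n (position≤length σ)
  ...   | false | inj₁ j∉σ rewrite above-absentʳ {y = k} j∉σ = refl
  ...   | false | inj₂ k∉σ rewrite above-absentˡ {y = j} k∉σ = refl

  bound≤length : ∀ σ j k → bound σ j k ≤ length σ
  bound≤length σ j k with j <ᵇ k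
  ... | false = ≤-refl
  ... | true with B j
  ...   | true = ⊔-lub (position≤length σ) (position≤length σ)
  ...   | false with above k j σ
  ...     | true  = position≤length σ
  ...     | false = ≤-refl

  respects-insert-min : ∀ p m σ j k → All (m <_) σ → p ≤ length σ →
                        respects (insertAt p m σ) m j k ≡ (p ≤ᵇ bound σ j k)
  respects-insert-min p m σ j k m<σ p≤len with m <ᵇ j | <ᵇ-reflects-< m j
  ... | false | ofⁿ m≮j = sym $
    trans (cong (p ≤ᵇ_) (bound-absent σ j k (inj₁ (absent-below (≮⇒≥ m≮j) m<σ)))) (≤⇒≤ᵇ≡true p≤len)
  ... | true | ofʸ m<j with j <ᵇ k | <ᵇ-reflects-< j k
  ...   | false | _ = sym (≤⇒≤ᵇ≡true p≤len)
  ...   | true | ofʸ j<k with B j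
  ...     | true
    rewrite above-insert p σ (>⇒≢ m<j) (absent-below ≤-refl m<σ) p≤len
          | above-insert p σ (>⇒≢ (<-trans m<j j<k)) (absent-below ≤-refl m<σ) p≤len
    = trans (cong not (sym (⊔-<ᵇ (position j σ) (position k σ) p))) (not-<ᵇ _ p)
  ...     | false
    rewrite above-insert p σ (>⇒≢ (<-trans m<j j<k)) (absent-below ≤-refl m<σ) p≤len
          | above-insert-other p σ (>⇒≢ (<-trans m<j j<k)) (>⇒≢ m<j)
    with above k j σ
  ...       | true  = trans (cong not (∧-identityʳ _)) (not-<ᵇ _ p)
  ...       | false = trans (cong not (∧-zeroʳ _)) (sym (≤⇒≤ᵇ≡true p≤len))

  inDomain-insert : ∀ p m σ → m ∈ alts n → All (m <_) σ → p ≤ length σ →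
                 inDomain n B (insertAt p m σ) ≡ inDomain n B σ ∧ (p ≤ᵇ threshold σ)
  inDomain-insert p m σ m∈ m<σ p≤len = Bool-ext to from
    where
      τ = insertAt p m σ

      to : T (inDomain n B τ) → T (inDomain n B σ ∧ (p ≤ᵇ threshold σ))
      to validτ = Equivalence.from (T-∧ {inDomain n B σ})
        (respects⇒inDomain σ okσ , ≤⇒≤ᵇ (≤-threshold σ p≤len p≤bound))
        where
          okσ : ∀ {i j k} → i ∈ alts n → j ∈ alts n → k ∈ alts n → T (respects σ i j k)
          okσ {i} {j} {k} i∈ j∈ k∈ with i ≟ m
          ... | yes refl = subst T (sym (respects-absent σ j k (absent-below ≤-refl m<σ))) _
          ... | no  i≢m  =
            subst T (respects-insert-other p m σ i j k i≢m m<σ) (inDomain⇒respects τ validτ i∈ j∈ k∈)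
          p≤bound : ∀ {j k} → j ∈ alts n → k ∈ alts n → p ≤ bound σ j k
          p≤bound {j} {k} j∈ k∈ =
            ≤ᵇ⇒≤ p _ (subst T (respects-insert-min p m σ j k m<σ p≤len)
                              (inDomain⇒respects τ validτ m∈ j∈ k∈))

      from : T (inDomain n B σ ∧ (p ≤ᵇ threshold σ)) → T (inDomain n B τ)
      from valid∧p≤t = respects⇒inDomain τ okτ
        where
          validσ = proj₁ (Equivalence.to (T-∧ {inDomain n B σ}) valid∧p≤t)
          p≤t    = ≤ᵇ⇒≤ p _ (proj₂ (Equivalence.to (T-∧ {inDomain n B σ}) valid∧p≤t))
          okτ : ∀ {i j k} → i ∈ alts n → j ∈ alts n → k ∈ alts n → T (respects τ i j k)
          okτ {i} {j} {k} i∈ j∈ k∈ with i ≟ m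
          ... | yes refl = subst T (sym (respects-insert-min p m σ j k m<σ p≤len))
                                 (≤⇒≤ᵇ (≤-trans p≤t (threshold≤bound σ j∈ k∈)))
          ... | no  i≢m  =
            subst T (sym (respects-insert-other p m σ i j k i≢m m<σ))
                    (inDomain⇒respects σ validσ i∈ j∈ k∈)

  bound-insert-other : ∀ p m σ {j k} → j ≢ m → k ≢ m → All (_≢ m) σ → p ≤ length σ →
                       bound (insertAt p m σ) j k ≡ shift p (bound σ j k)
  bound-insert-other p m σ {j} {k} j≢m k≢m m∉σ p≤len
    rewrite position-insert-other p σ j≢m p≤len | position-insert-other p σ k≢m p≤len
          | above-insert-other p σ k≢m j≢m
    with j <ᵇ k
  ... | false = trans (length-insert p σ p≤len) (sym (shift-≥ p≤len))
  ... | true with B j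
  ...   | true = shift-⊔ p (position j σ) (position k σ)
  ...   | false with above k j σ
  ...     | true  = refl
  ...     | false = trans (length-insert p σ p≤len) (sym (shift-≥ p≤len))

  bound-insert≤suc : ∀ p m σ j k → All (_≢ m) σ → p ≤ length σ →
                     bound (insertAt p m σ) j k ≤ suc (bound σ j k)
  bound-insert≤suc p m σ j k m∉σ p≤len with j ≟ m | k ≟ m
  ... | yes refl | _ rewrite bound-absent σ j k (inj₁ m∉σ) =
    subst (bound (insertAt p j σ) j k ≤_) (length-insert p σ p≤len) (bound≤length (insertAt p j σ) j k)
  ... | no _ | yes refl rewrite bound-absent σ j k (inj₂ m∉σ) =
    subst (bound (insertAt p k σ) j k ≤_) (length-insert p σ p≤len) (bound≤length (insertAt p k σ) j k)
  ... | no j≢m | no k≢m rewrite bound-insert-other p m σ j≢m k≢m m∉σ p≤len = shift≤suc p (bound σ j k)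

  threshold-insert≤suc : ∀ p m σ → All (_≢ m) σ → p ≤ length σ →
                         threshold (insertAt p m σ) ≤ suc (threshold σ)
  threshold-insert≤suc p m σ m∉σ p≤len =
    ≤-trans (≤-suc-pred (threshold τ)) (s≤s (≤-threshold σ pred≤length pred≤bound))
    where
      τ = insertAt p m σ
      pred≤length : pred (threshold τ) ≤ length σ
      pred≤length = pred-mono-≤ (subst (threshold τ ≤_) (length-insert p σ p≤len) (threshold≤length τ))
      pred≤bound : ∀ {j k} → j ∈ alts n → k ∈ alts n → pred (threshold τ) ≤ bound σ j k
      pred≤bound {j} {k} j∈ k∈ =
        pred-mono-≤ (≤-trans (threshold≤bound τ j∈ k∈) (bound-insert≤suc p m σ j k m∉σ p≤len))

  nextThreshold≤bound-insert : ∀ p m σ k → All (m <_) σ → p ≤ threshold σ →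
    nextThreshold (B m) p (threshold σ) ≤ bound (insertAt p m σ) m k
  nextThreshold≤bound-insert p m σ k m<σ p≤t with m <ᵇ k | <ᵇ-reflects-< m k
  ... | false | _ = ≤-trans (nextThreshold≤suc (B m) p≤t)
                            (subst (suc (threshold σ) ≤_) (sym (length-insert p σ p≤len))
                                   (s≤s (threshold≤length σ)))
    where p≤len = ≤-trans p≤t (threshold≤length σ)
  ... | true | ofʸ m<k with B m
  ...   | true
    rewrite position-insert p σ (absent-below ≤-refl m<σ) (≤-trans p≤t (threshold≤length σ))
          | position-insert-other p σ (>⇒≢ m<k) (≤-trans p≤t (threshold≤length σ))
    = below-max p
    where
      below-max : ∀ p → nextThreshold true p (threshold σ) ≤ p ⊔ shift p (position k σ)
      below-max zero    = s≤s z≤n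
      below-max (suc p) = m≤m⊔n (suc p) (shift (suc p) (position k σ))
  ...   | false
    rewrite above-insert p σ (>⇒≢ m<k) (absent-below ≤-refl m<σ) (≤-trans p≤t (threshold≤length σ))
    = below-length p
    where
      below-length : ∀ p → nextThreshold false p (threshold σ) ≤
        (if position k σ <ᵇ p then position k (insertAt p m σ) else length (insertAt p m σ))
      below-length zero    = s≤s (threshold≤length σ)
      below-length (suc p) = z≤n

  nextThreshold≤threshold-insert : ∀ p m σ → All (m <_) σ → p ≤ threshold σ →
    nextThreshold (B m) p (threshold σ) ≤ threshold (insertAt p m σ)
  nextThreshold≤threshold-insert p m σ m<σ p≤t = ≤-threshold τ next≤length next≤bound
    where
      τ = insertAt p m σ
      p≤len = ≤-trans p≤t (threshold≤length σ)
      m∉σ = absent-below ≤-refl m<σ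
      next = nextThreshold (B m) p (threshold σ)
      next≤suc = nextThreshold≤suc (B m) p≤t
      next≤length : next ≤ length τ
      next≤length = subst (next ≤_) (sym (length-insert {m} p σ p≤len))
                          (≤-trans next≤suc (s≤s (threshold≤length σ)))
      next≤bound : ∀ {j k} → j ∈ alts n → k ∈ alts n → next ≤ bound τ j k
      next≤bound {j} {k} j∈ k∈ with j ≟ m | k ≟ m
      ... | yes refl | _ = nextThreshold≤bound-insert p m σ k m<σ p≤t
      ... | no j≢m | yes refl with <-cmp j k
      ...   | tri< j<k _ _ = subst (next ≤_) (sym (bound-absent τ j k (inj₁ j∉τ))) next≤length
        where j∉τ = absent-insert p σ j≢m (absent-below (<⇒≤ j<k) m<σ)
      ...   | tri≈ _ j≡k _ = contradiction j≡k j≢m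
      ...   | tri> _ _ k<j rewrite ≥⇒<ᵇ≡false (<⇒≤ k<j) = next≤length
      next≤bound {j} {k} j∈ k∈ | no j≢m | no k≢m
        rewrite bound-insert-other p m σ j≢m k≢m m∉σ p≤len
              | shift-≥ (≤-trans p≤t (threshold≤bound σ j∈ k∈))
        = ≤-trans next≤suc (s≤s (threshold≤bound σ j∈ k∈))

  threshold-insert≤nextThreshold : ∀ p m σ → m ∈ alts n → All (m <_) σ → All (_∈ alts n) σ →
    p ≤ length σ → threshold (insertAt p m σ) ≤ nextThreshold (B m) p (threshold σ)
  -- Unless B m ≡ false and p ≡ 0, the triples (·, m, z) with z the top element of σ already
  -- force the bound.
  threshold-insert≤nextThreshold p m σ m∈ m<σ σ⊆ p≤len with B m in Bm
  threshold-insert≤nextThreshold zero m σ m∈ m<σ σ⊆ p≤len | false =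
    threshold-insert≤suc zero m σ (absent-below ≤-refl m<σ) p≤len
  threshold-insert≤nextThreshold (suc p) m (z ∷ zs) m∈ (m<z ∷ _) (z∈ ∷ _) _ | false =
    subst (threshold (z ∷ insertAt p m zs) ≤_) top-bound (threshold≤bound (z ∷ insertAt p m zs) m∈ z∈)
    where
      top-bound : bound (z ∷ insertAt p m zs) m z ≡ 0
      top-bound rewrite <⇒<ᵇ≡true m<z | Bm | ≡ᵇ-refl z | elem-insert {m} p zs = refl
  threshold-insert≤nextThreshold zero m [] _ _ _ _ | true = threshold≤length (m ∷ [])
  threshold-insert≤nextThreshold zero m (z ∷ zs) m∈ (m<z ∷ _) (z∈ ∷ _) _ | true =
    subst (threshold (m ∷ z ∷ zs) ≤_) top-bound (threshold≤bound (m ∷ z ∷ zs) m∈ z∈)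
    where
      top-bound : bound (m ∷ z ∷ zs) m z ≡ 1
      top-bound rewrite <⇒<ᵇ≡true m<z | Bm | ≡ᵇ-refl m | ≢⇒≡ᵇ≡false (<⇒≢ m<z) | ≡ᵇ-refl z = refl
  threshold-insert≤nextThreshold (suc p) m (z ∷ zs) m∈ (m<z ∷ m<zs) (z∈ ∷ _) (s≤s p≤len) | true =
    subst (threshold (z ∷ insertAt p m zs) ≤_) top-bound (threshold≤bound (z ∷ insertAt p m zs) m∈ z∈)
    where
      top-bound : bound (z ∷ insertAt p m zs) m z ≡ suc p
      top-bound rewrite <⇒<ᵇ≡true m<z | Bm | ≢⇒≡ᵇ≡false (>⇒≢ m<z) | ≡ᵇ-refl z
                      | position-insert p zs (absent-below ≤-refl m<zs) p≤len = ⊔-identityʳ (suc p)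

  threshold-insert : ∀ p m σ → m ∈ alts n → All (m <_) σ → All (_∈ alts n) σ → p ≤ threshold σ →
                     threshold (insertAt p m σ) ≡ nextThreshold (B m) p (threshold σ)
  threshold-insert p m σ m∈ m<σ σ⊆ p≤t = ≤-antisym
    (threshold-insert≤nextThreshold p m σ m∈ m<σ σ⊆ (≤-trans p≤t (threshold≤length σ)))
    (nextThreshold≤threshold-insert p m σ m<σ p≤t)

-- Sums and the counting recursion

∑≤ : (ℕ → ℕ) → ℕ → ℕ
∑≤ f zero    = f 0
∑≤ f (suc t) = f 0 + ∑≤ (f ∘ suc) t

syntax ∑≤ (λ p → e) t = ∑[ p ≤ t ] e

∑≤-cong : ∀ {f g} t → (∀ {p} → p ≤ t → f p ≡ g p) → ∑≤ f t ≡ ∑≤ g t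
∑≤-cong zero    f≡g = f≡g z≤n
∑≤-cong (suc t) f≡g = cong₂ _+_ (f≡g z≤n) (∑≤-cong t (f≡g ∘ s≤s))

∑≤-const : ∀ c t → ∑[ p ≤ t ] c ≡ suc t * c
∑≤-const c zero    = sym (+-identityʳ c)
∑≤-const c (suc t) = cong (c +_) (∑≤-const c t)

∑≤-zero : ∀ t → ∑[ p ≤ t ] 0 ≡ 0
∑≤-zero t = trans (∑≤-const 0 t) (*-zeroʳ (suc t))

∑≤-truncate : ∀ f {t L} → t ≤ L → ∑[ p ≤ L ] (if p ≤ᵇ t then f p else 0) ≡ ∑≤ f t
∑≤-truncate f {zero}  {zero}  _ = refl
∑≤-truncate f {zero}  {suc L} _ = trans (cong (f 0 +_) (∑≤-zero L)) (+-identityʳ (f 0))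
∑≤-truncate f {suc t} {suc L} (s≤s t≤L) = cong (f 0 +_) $
  trans (∑≤-cong L λ {p} _ → cong (if_then f (suc p) else 0) (sym (≤ᵇ≡<ᵇsuc p t)))
        (∑≤-truncate (f ∘ suc) t≤L)

sum-map-concatMap : ∀ (F : List ℕ → ℕ) (g : List ℕ → List (List ℕ)) L →
                    sum (map F (concatMap g L)) ≡ sum (map (sum ∘ map F ∘ g) L)
sum-map-concatMap F g []      = refl
sum-map-concatMap F g (σ ∷ L) = begin
  sum (map F (g σ ++ concatMap g L))             ≡⟨ cong sum (map-++ F (g σ) (concatMap g L)) ⟩
  sum (map F (g σ) ++ map F (concatMap g L))     ≡⟨ sum-++ (map F (g σ)) _ ⟩
  sum (map F (g σ)) + sum (map F (concatMap g L))
    ≡⟨ cong (sum (map F (g σ)) +_) (sum-map-concatMap F g L) ⟩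
  sum (map F (g σ)) + sum (map (sum ∘ map F ∘ g) L) ∎
  where open ≡-Reasoning

sum-map-insertions : ∀ (F : List ℕ → ℕ) x σ →
                     sum (map F (insertions x σ)) ≡ ∑[ p ≤ length σ ] F (insertAt p x σ)
sum-map-insertions F x []       = +-identityʳ (F (x ∷ []))
sum-map-insertions F x (y ∷ ys) = cong (F (x ∷ y ∷ ys) +_) $
  trans (cong sum (sym (map-∘ (insertions x ys)))) (sum-map-insertions (F ∘ (y ∷_)) x ys)

sum-map-cong : ∀ {P : List ℕ → Set} {F G : List ℕ → ℕ} {L} → All P L →
               (∀ {σ} → P σ → F σ ≡ G σ) → sum (map F L) ≡ sum (map G L)
sum-map-cong []         F≡G = refl
sum-map-cong (pσ ∷ pL) F≡G = cong₂ _+_ (F≡G pσ) (sum-map-cong pL F≡G)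

length-filter : ∀ (f : List ℕ → Bool) L →
                length (filter (λ σ → T? (f σ)) L) ≡ sum (map (λ σ → if f σ then 1 else 0) L)
length-filter f []      = refl
length-filter f (σ ∷ L) with f σ
... | true  = cong suc (length-filter f L)
... | false = length-filter f L

module _ {P : ℕ → Set} where

  All-insertions : ∀ {x} σ → P x → All P σ → All (All P) (insertions x σ)
  All-insertions []       px []         = (px ∷ []) ∷ []
  All-insertions (y ∷ ys) px (py ∷ pys) =
    (px ∷ py ∷ pys) ∷ map⁺ (All.map (py ∷_) (All-insertions ys px pys))

  All-perms : ∀ xs → All P xs → All (All P) (perms xs)
  All-perms []       []         = [] ∷ []
  All-perms (x ∷ xs) (px ∷ pxs) =
    concat⁺ (map⁺ (All.map (λ {σ} → All-insertions σ px) (All-perms xs pxs)))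

interval : ℕ → ℕ → List ℕ
interval a zero    = []
interval a (suc k) = a ∷ interval (suc a) k

applyUpTo-interval : ∀ (f : ℕ → ℕ) k → (∀ i → f (suc i) ≡ suc (f i)) → applyUpTo f k ≡ interval (f 0) k
applyUpTo-interval f zero    _     = refl
applyUpTo-interval f (suc k) f-suc = cong (f 0 ∷_) $
  trans (applyUpTo-interval (f ∘ suc) k (f-suc ∘ suc)) (cong (λ a → interval a k) (f-suc 0))

alts≡interval : ∀ n → alts n ≡ interval 1 n
alts≡interval n = trans (map-applyUpTo id suc n) (applyUpTo-interval suc n λ _ → refl)

interval-bounds : ∀ a k → All (λ z → a ≤ z × z < a + k) (interval a k)
interval-bounds a zero    = []
interval-bounds a (suc k) = (≤-refl , m<m+n a z<s) ∷
  All.map (λ {z} (a<z , z<) → <⇒≤ a<z , subst (z <_) (sym (+-suc a k)) z<) (interval-bounds (suc a) k)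

∈-interval : ∀ {a k z} → a ≤ z → z < a + k → z ∈ interval a k
∈-interval {a} {zero}  a≤z z<a+0 = contradiction (subst (_ <_) (+-identityʳ a) z<a+0) (≤⇒≯ a≤z)
∈-interval {a} {suc k} {z} a≤z z<a+k with a ≟ z
... | yes refl = here refl
... | no  a≢z  = there (∈-interval (≤∧≢⇒< a≤z a≢z) (subst (z <_) (+-suc a k) z<a+k))

∈-alts : ∀ {n z} → 1 ≤ z → z ≤ n → z ∈ alts n
∈-alts {n} 1≤z z≤max = subst (_ ∈_) (sym (alts≡interval n)) (∈-interval 1≤z (s≤s z≤max))

completions : (ℕ → Bool) → ℕ → ℕ → ℕ
completions B zero    t = 1
completions B (suc m) t = ∑[ p ≤ t ] completions B m (nextThreshold (B (suc m)) p t)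

module Counting (n : ℕ) (B : ℕ → Bool) where
  open Insertion n B

  weight : ℕ → List ℕ → ℕ
  weight m σ = if inDomain n B σ then completions B m (threshold σ) else 0

  sum-weight-insertions : ∀ m σ → suc m ∈ alts n → All (suc m <_) σ → All (_∈ alts n) σ →
                          sum (map (weight m) (insertions (suc m) σ)) ≡ weight (suc m) σ
  sum-weight-insertions m σ m∈ m<σ σ⊆ =
    trans (sum-map-insertions (weight m) (suc m) σ) (trans (∑≤-cong (length σ) weight-insert) collapse)
    where
      t = threshold σ
      next = λ p → nextThreshold (B (suc m)) p t
      weight-insert : ∀ {p} → p ≤ length σ → weight m (insertAt p (suc m) σ) ≡
        (if inDomain n B σ then (if p ≤ᵇ t then completions B m (next p) else 0) else 0)
      weight-insert {p} p≤len rewrite inDomain-insert p (suc m) σ m∈ m<σ p≤len with inDomain n B σ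
      ... | false = refl
      ... | true with p ≤ᵇ t | ≤ᵇ-reflects-≤ p t
      ...   | false | _       = refl
      ...   | true  | ofʸ p≤t = cong (completions B m) (threshold-insert p (suc m) σ m∈ m<σ σ⊆ p≤t)
      collapse : ∑[ p ≤ length σ ]
                   (if inDomain n B σ then (if p ≤ᵇ t then completions B m (next p) else 0) else 0)
               ≡ weight (suc m) σ
      collapse with inDomain n B σ
      ... | false = ∑≤-zero (length σ)
      ... | true  = ∑≤-truncate (completions B m ∘ next) (threshold≤length σ)

  inDomain-[] : inDomain n B [] ≡ true
  inDomain-[] = Equivalence.to T-≡ $ respects⇒inDomain [] λ {_} {j} {k} _ _ _ →
    subst T (sym (respects-absent [] j k [])) _

  sum-weight-perms : ∀ k m → m + k ≡ n →
                     sum (map (weight m) (perms (interval (suc m) k))) ≡ completions B n 0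
  sum-weight-perms zero m m+0≡n
    rewrite inDomain-[] | n≤0⇒n≡0 (threshold≤length []) | sym m+0≡n | +-identityʳ m = +-identityʳ _
  sum-weight-perms (suc k) m m+k+1≡n = begin
    sum (map (weight m) (concatMap (insertions (suc m)) (perms ms)))
      ≡⟨ sum-map-concatMap (weight m) (insertions (suc m)) (perms ms) ⟩
    sum (map (sum ∘ map (weight m) ∘ insertions (suc m)) (perms ms))
      ≡⟨ sum-map-cong (All-perms ms ms-bounds)
           (λ {σ} bσ → sum-weight-insertions m σ m∈ (All.map proj₁ bσ) (All.map proj₂ bσ)) ⟩
    sum (map (weight (suc m)) (perms ms))
      ≡⟨ sum-weight-perms k (suc m) (trans (sym (+-suc m k)) m+k+1≡n) ⟩
    completions B n 0 ∎
    where
      open ≡-Reasoning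
      ms = interval (suc (suc m)) k
      m∈ : suc m ∈ alts n
      m∈ = ∈-alts (s≤s z≤n) (subst (suc m ≤_) (trans (sym (+-suc m k)) m+k+1≡n) (s≤s (m≤m+n m k)))
      ms-bounds : All (λ z → suc m < z × z ∈ alts n) ms
      ms-bounds = All.map (λ {z} (m<z , z<) → m<z , ∈-alts (≤-trans (s≤s z≤n) m<z)
                            (≤-pred (subst (z <_) (cong suc (trans (sym (+-suc m k)) m+k+1≡n)) z<)))
                          (interval-bounds (suc (suc m)) k)

a≡completions : ∀ n → a n ≡ completions (A n) n 0
a≡completions n = begin
  a n                                          ≡⟨ length-filter (inDomain n (A n)) (perms (alts n)) ⟩
  sum (map (weight 0) (perms (alts n)))        ≡⟨ cong (sum ∘ map (weight 0) ∘ perms) (alts≡interval n) ⟩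
  sum (map (weight 0) (perms (interval 1 n)))  ≡⟨ sum-weight-perms n 0 refl ⟩
  completions (A n) n 0                        ∎
  where
    open ≡-Reasoning
    open Counting n (A n)

-- Parity and binomial coefficients modulo 2

odd : ℕ → Bool
odd zero          = false
odd (suc zero)    = true
odd (suc (suc n)) = odd n

even : ℕ → Bool
even n = not (odd n)

odd-suc : ∀ n → odd (suc n) ≡ not (odd n)
odd-suc zero          = refl
odd-suc (suc zero)    = refl
odd-suc (suc (suc n)) = odd-suc n

odd-+ : ∀ m n → odd (m + n) ≡ odd m xor odd n
odd-+ zero          n = refl
odd-+ (suc zero)    n = odd-suc n
odd-+ (suc (suc m)) n = odd-+ m n

odd-* : ∀ m n → odd (m * n) ≡ odd m ∧ odd n
odd-* zero    n = refl
odd-* (suc m) n = begin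
  odd (n + m * n)              ≡⟨ odd-+ n (m * n) ⟩
  odd n xor odd (m * n)        ≡⟨ cong (odd n xor_) (odd-* m n) ⟩
  odd n xor (odd m ∧ odd n)    ≡⟨ absorb (odd m) ⟩
  not (odd m) ∧ odd n          ≡⟨ cong (_∧ odd n) (odd-suc m) ⟨
  odd (suc m) ∧ odd n          ∎
  where
    open ≡-Reasoning
    absorb : ∀ b → odd n xor (b ∧ odd n) ≡ not b ∧ odd n
    absorb true  = xor-same (odd n)
    absorb false = xor-identityʳ (odd n)

odd-+-self : ∀ m → odd (m + m) ≡ false
odd-+-self m = trans (odd-+ m m) (xor-same (odd m))

%2≡odd : ∀ n → n % 2 ≡ (if odd n then 1 else 0)
%2≡odd zero          = refl
%2≡odd (suc zero)    = refl
%2≡odd (suc (suc n)) = %2≡odd n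

%2≡1⇔odd : ∀ n → (n % 2 ≡ 1) ⇔ (odd n ≡ true)
%2≡1⇔odd n with odd n | %2≡odd n
... | true  | n%2≡1 = mk⇔ (λ _ → refl) (λ _ → n%2≡1)
... | false | n%2≡0 = mk⇔ (λ n%2≡1 → contradiction (trans (sym n%2≡0) n%2≡1) λ ()) λ ()

double : ℕ → ℕ
double zero    = zero
double (suc k) = suc (suc (double k))

odd-double : ∀ k → odd (double k) ≡ false
odd-double zero    = refl
odd-double (suc k) = odd-double k

odd-suc-double : ∀ k → odd (suc (double k)) ≡ true
odd-suc-double zero    = refl
odd-suc-double (suc k) = odd-suc-double k

data ParityView : ℕ → Set where
  even-view : ∀ k → ParityView (double k)
  odd-view  : ∀ k → ParityView (suc (double k))

parityView : ∀ n → ParityView n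
parityView zero = even-view zero
parityView (suc n) with parityView n
... | even-view k = odd-view k
... | odd-view  k = even-view (suc k)

double≡2* : ∀ k → double k ≡ 2 * k
double≡2* zero    = refl
double≡2* (suc k) = cong suc (trans (cong suc (double≡2* k)) (sym (+-suc k (k + 0))))

double-injective : ∀ {x y} → double x ≡ double y → x ≡ y
double-injective {zero}  {zero}  _  = refl
double-injective {suc x} {suc y} eq = cong suc (double-injective (suc-injective (suc-injective eq)))

2^-cancel-< : ∀ {m n} → 2 ^ m < 2 ^ n → m < n
2^-cancel-< {m} {n} 2^m<2^n = ≰⇒> λ n≤m → <⇒≱ 2^m<2^n (^-monoʳ-≤ 2 n≤m)

2^-cancel-≤ : ∀ {m n} → 2 ^ m ≤ 2 ^ n → m ≤ n
2^-cancel-≤ {m} {n} 2^m≤2^n = ≮⇒≥ λ n<m → <⇒≱ (^-monoʳ-< 2 (s≤s (s≤s z≤n)) n<m) 2^m≤2^n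

odd-∑≤ : ∀ {f g} t → (∀ p → odd (f p) ≡ odd (g p)) → odd (∑≤ f t) ≡ odd (∑≤ g t)
odd-∑≤ {f} {g} zero    f≡g = f≡g 0
odd-∑≤ {f} {g} (suc t) f≡g = begin
  odd (f 0 + ∑≤ (f ∘ suc) t)          ≡⟨ odd-+ (f 0) _ ⟩
  odd (f 0) xor odd (∑≤ (f ∘ suc) t)  ≡⟨ cong₂ _xor_ (f≡g 0) (odd-∑≤ t (f≡g ∘ suc)) ⟩
  odd (g 0) xor odd (∑≤ (g ∘ suc) t)  ≡⟨ odd-+ (g 0) _ ⟨
  odd (g 0 + ∑≤ (g ∘ suc) t)          ∎
  where open ≡-Reasoning

odd-cancelʳ : ∀ x y {z} → x + y ≡ z → odd x ≡ odd z xor odd y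
odd-cancelʳ x y refl = begin
  odd x                           ≡⟨ xor-identityʳ (odd x) ⟨
  odd x xor false                 ≡⟨ cong (odd x xor_) (xor-same (odd y)) ⟨
  odd x xor (odd y xor odd y)     ≡⟨ xor-assoc (odd x) (odd y) (odd y) ⟨
  (odd x xor odd y) xor odd y     ≡⟨ cong (_xor odd y) (odd-+ x y) ⟨
  odd (x + y) xor odd y           ∎
  where open ≡-Reasoning

-- The coefficient of X^(d + N) in (1 + X)^(x + N) ≡ (1 + X)^x (1 + X^N) (mod 2).
FreshmanDream : ℕ → Set
FreshmanDream N = ∀ x d → odd ((x + N) C (d + N)) ≡ odd (x C (d + N)) xor odd (x C d)

2^suc : ∀ j → 2 ^ suc j ≡ 2 ^ j + 2 ^ j
2^suc j = cong (2 ^ j +_) (+-identityʳ (2 ^ j))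

freshmanDream-1 : FreshmanDream 1
freshmanDream-1 x d rewrite +-comm x 1 | +-comm d 1 =
  trans (cong odd (sym (nCk+nC[k+1]≡[n+1]C[k+1] x d)))
        (trans (odd-+ (x C d) (x C suc d)) (xor-comm (odd (x C d)) (odd (x C suc d))))

freshmanDream-double : ∀ {N} → FreshmanDream N → FreshmanDream (N + N)
freshmanDream-double {N} dream x d
  rewrite sym (+-assoc x N N) | sym (+-assoc d N N) | dream (x + N) (d + N) | dream x (d + N) | dream x d
  = xor-cancel-middle (odd (x C (d + N + N))) (odd (x C (d + N))) (odd (x C d))

freshmanDream : ∀ j → FreshmanDream (2 ^ j)
freshmanDream zero    = freshmanDream-1
freshmanDream (suc j) = subst FreshmanDream (sym (2^suc j)) (freshmanDream-double (freshmanDream j))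

hockeyStick : ∀ t c d → ∑[ p ≤ t ] ((p + c) C d) + c C suc d ≡ (suc t + c) C suc d
hockeyStick zero    c d = nCk+nC[k+1]≡[n+1]C[k+1] c d
hockeyStick (suc t) c d = begin
  (c C d + ∑[ p ≤ t ] ((suc p + c) C d)) + c C suc d
    ≡⟨ cong (λ s → (c C d + s) + c C suc d) (∑≤-cong t λ {p} _ → cong (_C d) (sym (+-suc p c))) ⟩
  (c C d + ∑[ p ≤ t ] ((p + suc c) C d)) + c C suc d
    ≡⟨ swap (c C d) (∑[ p ≤ t ] ((p + suc c) C d)) (c C suc d) ⟩
  ∑[ p ≤ t ] ((p + suc c) C d) + (c C d + c C suc d)
    ≡⟨ cong (∑[ p ≤ t ] ((p + suc c) C d) +_) (nCk+nC[k+1]≡[n+1]C[k+1] c d) ⟩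
  ∑[ p ≤ t ] ((p + suc c) C d) + suc c C suc d
    ≡⟨ hockeyStick t (suc c) d ⟩
  (suc t + suc c) C suc d
    ≡⟨ cong (_C suc d) (+-suc (suc t) c) ⟩
  (suc (suc t) + c) C suc d ∎
  where
    open ≡-Reasoning
    swap : ∀ x y z → (x + y) + z ≡ y + (x + z)
    swap x y z = trans (cong (_+ z) (+-comm x y)) (+-assoc y x z)

-- Completions for the alternating scheme

alternating : ℕ → ℕ → ℕ
alternating i = completions even (suc (double i))

alternating-zero : ∀ t → alternating 0 t ≡ suc t
alternating-zero t = trans (∑≤-const 1 t) (*-identityʳ (suc t))

∑≤-nextThreshold-false : ∀ (f : ℕ → ℕ) t → ∑[ p ≤ t ] f (nextThreshold false p t) ≡ f (suc t) + t * f 0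
∑≤-nextThreshold-false f zero    = sym (+-identityʳ (f 1))
∑≤-nextThreshold-false f (suc t) = cong (f (suc (suc t)) +_) (∑≤-const (f 0) t)

alternating-suc : ∀ i t →
  alternating (suc i) t ≡ suc t * alternating i 1 + ∑[ p ≤ t ] alternating i (suc p)
alternating-suc i t = begin
  ∑[ p ≤ t ] g (nextThreshold (even (suc (double (suc i)))) p t)
    ≡⟨ cong (λ b → ∑[ p ≤ t ] g (nextThreshold (not b) p t)) (odd-suc-double (suc i)) ⟩
  ∑[ p ≤ t ] g (nextThreshold false p t)
    ≡⟨ ∑≤-nextThreshold-false g t ⟩
  g (suc t) + t * g 0
    ≡⟨ cong₂ (λ x y → x + t * y) (g≡ (suc t)) (g≡ 0) ⟩
  (a₁ + s) + t * a₁
    ≡⟨ +-assoc a₁ s (t * a₁) ⟩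
  a₁ + (s + t * a₁)
    ≡⟨ cong (a₁ +_) (+-comm s (t * a₁)) ⟩
  a₁ + (t * a₁ + s)
    ≡⟨ +-assoc a₁ (t * a₁) s ⟨
  suc t * a₁ + s ∎
  where
    open ≡-Reasoning
    g  = completions even (double (suc i))
    a₁ = alternating i 1
    s  = ∑[ p ≤ t ] alternating i (suc p)
    g≡ : ∀ u → g u ≡ ∑[ p ≤ u ] alternating i (nextThreshold true p u)
    g≡ u = cong (λ b → ∑[ p ≤ u ] alternating i (nextThreshold (not b) p u)) (odd-double (suc i))

odd-alternating-suc : ∀ i c d → (∀ t → odd (alternating i t) ≡ odd ((t + c) C d)) → ∀ t →
  odd (alternating (suc i) t) ≡
    (odd (suc t) ∧ odd (suc c C d)) xor odd ((suc t + suc c) C suc d) xor odd (suc c C suc d)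
odd-alternating-suc i c d odd-alt t = begin
  odd (alternating (suc i) t)
    ≡⟨ cong odd (alternating-suc i t) ⟩
  odd (suc t * alternating i 1 + ∑[ p ≤ t ] alternating i (suc p))
    ≡⟨ odd-+ (suc t * alternating i 1) _ ⟩
  odd (suc t * alternating i 1) xor odd (∑[ p ≤ t ] alternating i (suc p))
    ≡⟨ cong₂ _xor_ (trans (odd-* (suc t) (alternating i 1)) (cong (odd (suc t) ∧_) (odd-alt 1)))
                   (odd-∑≤ t λ p → trans (odd-alt (suc p)) (cong (odd ∘ (_C d)) (sym (+-suc p c)))) ⟩
  (odd (suc t) ∧ odd (suc c C d)) xor odd (∑[ p ≤ t ] ((p + suc c) C d))
    ≡⟨ cong ((odd (suc t) ∧ odd (suc c C d)) xor_)
            (odd-cancelʳ (∑[ p ≤ t ] ((p + suc c) C d)) (suc c C suc d) (hockeyStick t (suc c) d)) ⟩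
  (odd (suc t) ∧ odd (suc c C d)) xor odd ((suc t + suc c) C suc d) xor odd (suc c C suc d) ∎
  where open ≡-Reasoning

Block : ℕ → ℕ → Set
Block N r = ∀ t → odd (alternating (r + N) t) ≡ odd ((t + suc (r + r)) C suc (r + N))

block-1-0 : Block 1 0
block-1-0 t = begin
  odd (alternating 1 t)
    ≡⟨ odd-alternating-suc 0 1 1 odd-alternating-0 t ⟩
  (odd (suc t) ∧ false) xor odd ((suc t + 2) C 2) xor true
    ≡⟨ cong (_xor (odd ((suc t + 2) C 2) xor true)) (∧-zeroʳ (odd (suc t))) ⟩
  odd ((suc t + 2) C 2) xor true
    ≡⟨ cong (λ x → odd ((x + 2) C 2) xor true) (+-comm 1 t) ⟩
  odd ((t + 1 + 2) C 2) xor true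
    ≡⟨ cong (_xor true) (freshmanDream 1 (t + 1) 0) ⟩
  (odd ((t + 1) C 2) xor true) xor true
    ≡⟨ xor-assoc (odd ((t + 1) C 2)) true true ⟩
  odd ((t + 1) C 2) xor false
    ≡⟨ xor-identityʳ _ ⟩
  odd ((t + 1) C 2) ∎
  where
    open ≡-Reasoning
    odd-alternating-0 : ∀ t → odd (alternating 0 t) ≡ odd ((t + 1) C 1)
    odd-alternating-0 t =
      cong odd (trans (alternating-zero t) (sym (trans (nC1≡n (t + 1)) (+-comm t 1))))

block-suc : ∀ {N r} → suc r < N → Block N r → Block N (suc r)
block-suc {N} {r} r+1<N block t = begin
  odd (alternating (suc (r + N)) t)
    ≡⟨ odd-alternating-suc (r + N) c d block t ⟩
  (odd (suc t) ∧ odd (suc c C d)) xor odd ((suc t + suc c) C suc d) xor odd (suc c C suc d)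
    ≡⟨ cong₂ (λ x y → (odd (suc t) ∧ odd x) xor odd ((suc t + suc c) C suc d) xor odd y)
             (k>n⇒nCk≡0 c<d) (k>n⇒nCk≡0 (m<n⇒m<1+n c<d)) ⟩
  (odd (suc t) ∧ false) xor odd ((suc t + suc c) C suc d) xor false
    ≡⟨ trans (cong (_xor (odd ((suc t + suc c) C suc d) xor false)) (∧-zeroʳ (odd (suc t))))
             (xor-identityʳ (odd ((suc t + suc c) C suc d))) ⟩
  odd ((suc t + suc c) C suc d)
    ≡⟨ cong (λ x → odd (x C suc d)) (sym (+-suc t (suc c))) ⟩
  odd ((t + suc (suc c)) C suc d)
    ≡⟨ cong (λ x → odd ((t + suc (suc x)) C suc d)) (sym (+-suc r r)) ⟩
  odd ((t + suc (suc r + suc r)) C suc d) ∎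
  where
    open ≡-Reasoning
    c = suc (r + r)
    d = suc (r + N)
    c<d : suc c < d
    c<d = s≤s (subst (_< r + N) (+-suc r r) (+-monoʳ-< r r+1<N))

block-double : ∀ {r} → FreshmanDream (suc r + suc r) → Block (suc r) r → Block (suc r + suc r) 0
block-double {r} dream block t = begin
  odd (alternating M t)
    ≡⟨ odd-alternating-suc (r + suc r) c M block t ⟩
  (odd (suc t) ∧ odd (suc c C M)) xor odd ((suc t + suc c) C suc M) xor odd (suc c C suc M)
    ≡⟨ cong (λ x → (odd (suc t) ∧ odd (x C M)) xor odd ((suc t + x) C suc M) xor odd (x C suc M)) c+1≡M ⟩
  (odd (suc t) ∧ odd (M C M)) xor odd ((suc t + M) C suc M) xor odd (M C suc M)
    ≡⟨ cong₂ (λ x y → (odd (suc t) ∧ odd x) xor odd ((suc t + M) C suc M) xor odd y)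
             (nCn≡1 M) (k>n⇒nCk≡0 (n<1+n M)) ⟩
  (odd (suc t) ∧ true) xor odd ((suc t + M) C suc M) xor false
    ≡⟨ cong₂ _xor_ (∧-identityʳ (odd (suc t))) (xor-identityʳ (odd ((suc t + M) C suc M))) ⟩
  odd (suc t) xor odd ((suc t + M) C (1 + M))
    ≡⟨ cong (odd (suc t) xor_) (dream (suc t) 1) ⟩
  odd (suc t) xor (odd (suc t C suc M) xor odd (suc t C 1))
    ≡⟨ cong (λ x → odd (suc t) xor (odd (suc t C suc M) xor odd x)) (nC1≡n (suc t)) ⟩
  odd (suc t) xor (odd (suc t C suc M) xor odd (suc t))
    ≡⟨ xor-cancel-outer (odd (suc t)) (odd (suc t C suc M)) ⟩
  odd (suc t C suc M)
    ≡⟨ cong (λ x → odd (x C suc M)) (+-comm 1 t) ⟩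
  odd ((t + 1) C suc M) ∎
  where
    open ≡-Reasoning
    M = suc r + suc r
    c = suc (r + r)
    c+1≡M : suc c ≡ M
    c+1≡M = cong suc (sym (+-suc r r))

-- Inside a dyadic block the boundary terms of odd-alternating-suc vanish; passing to the next
-- block they are absorbed by the freshman's dream.
block : ∀ j r → r < 2 ^ j → Block (2 ^ j) r
block j       (suc r) r+1<2^j = block-suc r+1<2^j (block j r (<-trans (n<1+n r) r+1<2^j))
block zero    zero    _       = block-1-0
block (suc j) zero    _       = subst (λ N → Block N 0) (sym (2^suc j))
  (doubling (2 ^ j) (m^n>0 2 j) (block j) (subst FreshmanDream (2^suc j) (freshmanDream (suc j))))
  where
    doubling : ∀ N → 0 < N → (∀ r → r < N → Block N r) → FreshmanDream (N + N) → Block (N + N) 0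
    doubling (suc r) _ blocks dream = block-double dream (blocks r ≤-refl)

binaryDecomposition : ∀ i → ∃[ j ] ∃[ r ] (r < 2 ^ j × suc i ≡ r + 2 ^ j)
binaryDecomposition zero = 0 , 0 , s≤s z≤n , refl
binaryDecomposition (suc i) with binaryDecomposition i
... | j , r , r<2^j , i+1≡ with suc r <? 2 ^ j
...   | yes r+1<2^j = j , suc r , r+1<2^j , cong suc i+1≡
...   | no  r+1≮2^j = suc j , 0 , m^n>0 2 (suc j) ,
  trans (cong suc i+1≡) (trans (cong (_+ 2 ^ j) (≤-antisym r<2^j (≮⇒≥ r+1≮2^j))) (sym (2^suc j)))

completions-cong : ∀ {B B′} m t → (∀ {j} → 2 ≤ j → j ≤ m → B j ≡ B′ j) →
                   completions B m t ≡ completions B′ m t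
completions-cong zero          t _    = refl
completions-cong (suc zero)    t _    = refl
completions-cong {B} {B′} (suc (suc m)) t B≡B′ = begin
  ∑[ p ≤ t ] completions B (suc m) (nextThreshold (B (suc (suc m))) p t)
    ≡⟨ cong (λ b → ∑[ p ≤ t ] completions B (suc m) (nextThreshold b p t)) (B≡B′ (s≤s (s≤s z≤n)) ≤-refl) ⟩
  ∑[ p ≤ t ] completions B (suc m) (nextThreshold (B′ (suc (suc m))) p t)
    ≡⟨ ∑≤-cong t (λ {p} _ → completions-cong (suc m) (nextThreshold (B′ (suc (suc m))) p t)
                              λ 2≤j j≤m → B≡B′ 2≤j (m≤n⇒m≤1+n j≤m)) ⟩
  ∑[ p ≤ t ] completions B′ (suc m) (nextThreshold (B′ (suc (suc m))) p t) ∎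
  where open ≡-Reasoning

even-below-cutoff : ∀ j n → odd j ≡ false → j < n → j ≤ n ∸ 2 + n % 2
even-below-cutoff zero                n                         _ _ = z≤n
even-below-cutoff (suc zero)          n                         () _
even-below-cutoff (suc (suc j))       (suc (suc zero))          _ (s≤s (s≤s ()))
even-below-cutoff (suc (suc zero))    (suc (suc (suc zero)))    _ _ = s≤s (s≤s z≤n)
even-below-cutoff (suc (suc (suc j))) (suc (suc (suc zero)))    _ (s≤s (s≤s (s≤s ())))
even-below-cutoff (suc (suc j)) (suc (suc (suc (suc n)))) j-even (s≤s (s≤s j<n)) =
  s≤s (s≤s (even-below-cutoff j (suc (suc n)) j-even j<n))

A≡even : ∀ n {j} → 2 ≤ j → j < n → A n j ≡ even j
A≡even n {j} 2≤j j<n rewrite %2≡odd j | <⇒<ᵇ≡true 2≤j with odd j in odd-j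
... | true  = refl
... | false = <⇒<ᵇ≡true (s≤s (even-below-cutoff j n odd-j j<n))

a[1+n]≡completions-even : ∀ n → a (suc n) ≡ completions even n 1
a[1+n]≡completions-even n = begin
  a (suc n)                                                   ≡⟨ a≡completions (suc n) ⟩
  completions (A (suc n)) n (nextThreshold (A (suc n) (suc n)) 0 0)
    ≡⟨ cong (completions (A (suc n)) n) (nextThreshold-0-0 (A (suc n) (suc n))) ⟩
  completions (A (suc n)) n 1
    ≡⟨ completions-cong n 1 (λ 2≤j j≤n → A≡even (suc n) 2≤j (s≤s j≤n)) ⟩
  completions even n 1 ∎
  where
    open ≡-Reasoning
    nextThreshold-0-0 : ∀ b → nextThreshold b 0 0 ≡ 1
    nextThreshold-0-0 true  = refl
    nextThreshold-0-0 false = refl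

odd-a[3+2k] : ∀ k → odd (a (suc (double (suc k)))) ≡ false
odd-a[3+2k] k = begin
  odd (a (suc (double (suc k))))
    ≡⟨ cong odd (a[1+n]≡completions-even (double (suc k))) ⟩
  odd (∑[ p ≤ 1 ] alternating k (nextThreshold (even (double (suc k))) p 1))
    ≡⟨ cong (λ b → odd (∑[ p ≤ 1 ] alternating k (nextThreshold (not b) p 1))) (odd-double (suc k)) ⟩
  odd (alternating k 1 + alternating k 1)
    ≡⟨ odd-+-self (alternating k 1) ⟩
  false ∎
  where open ≡-Reasoning

odd-a[4+2i] : ∀ i {j r} → suc i ≡ r + 2 ^ j → r < 2 ^ j →
              odd (a (double (suc (suc i)))) ≡ odd (suc (suc (r + r)) C suc (r + 2 ^ j))
odd-a[4+2i] i {j} {r} i+1≡ r<2^j = begin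
  odd (a (double (suc (suc i))))   ≡⟨ cong odd (a[1+n]≡completions-even (suc (double (suc i)))) ⟩
  odd (alternating (suc i) 1)      ≡⟨ cong (λ i → odd (alternating i 1)) i+1≡ ⟩
  odd (alternating (r + 2 ^ j) 1)  ≡⟨ block j r r<2^j 1 ⟩
  odd (suc (suc (r + r)) C suc (r + 2 ^ j)) ∎
  where open ≡-Reasoning

odd-central⇔ : ∀ j r → r < 2 ^ j → (odd (suc (suc (r + r)) C suc (r + 2 ^ j)) ≡ true) ⇔ (suc r ≡ 2 ^ j)
odd-central⇔ j r r<2^j with suc r ≟ 2 ^ j
... | yes r+1≡2^j = mk⇔ (λ _ → r+1≡2^j) λ _ → cong odd (begin
  suc (suc (r + r)) C suc (r + 2 ^ j)  ≡⟨ cong (λ N → suc (suc (r + r)) C suc (r + N)) r+1≡2^j ⟨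
  suc (suc (r + r)) C suc (r + suc r)  ≡⟨ cong (λ x → suc (suc (r + r)) C suc x) (+-suc r r) ⟩
  suc (suc (r + r)) C suc (suc (r + r)) ≡⟨ nCn≡1 (suc (suc (r + r))) ⟩
  1                                    ∎)
  where open ≡-Reasoning
... | no  r+1≢2^j = mk⇔ (λ odd≡true → contradiction (trans (sym (cong odd C≡0)) odd≡true) λ ())
                        (λ r+1≡2^j → contradiction r+1≡2^j r+1≢2^j)
  where
    C≡0 : suc (suc (r + r)) C suc (r + 2 ^ j) ≡ 0
    C≡0 = k>n⇒nCk≡0 (s≤s (subst (_< r + 2 ^ j) (+-suc r r) (+-monoʳ-< r (≤∧≢⇒< r<2^j r+1≢2^j))))

double-pow2⇔ : ∀ j r → r < 2 ^ j → (∃[ t ] (1 < t × double (suc r + 2 ^ j) ≡ 2 ^ t)) ⇔ (suc r ≡ 2 ^ j)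
double-pow2⇔ j r r<2^j = mk⇔ to from
  where
    x = suc r + 2 ^ j
    to : ∃[ t ] (1 < t × double x ≡ 2 ^ t) → suc r ≡ 2 ^ j
    to (suc t , _ , double-x≡) =
      +-cancelʳ-≡ (2 ^ j) (suc r) (2 ^ j) (trans x≡2^t (trans (cong (2 ^_) t≡j+1) (2^suc j)))
      where
        x≡2^t : x ≡ 2 ^ t
        x≡2^t = double-injective (trans double-x≡ (sym (double≡2* (2 ^ t))))
        t≡j+1 : t ≡ suc j
        t≡j+1 = ≤-antisym
          (2^-cancel-≤ (subst (_≤ 2 ^ suc j) x≡2^t
                         (subst (x ≤_) (sym (2^suc j)) (+-monoˡ-≤ (2 ^ j) r<2^j))))
          (2^-cancel-< (subst (2 ^ j <_) x≡2^t (m<n+m (2 ^ j) z<s)))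
    from : suc r ≡ 2 ^ j → ∃[ t ] (1 < t × double x ≡ 2 ^ t)
    from r+1≡2^j = suc (suc j) , s≤s (s≤s z≤n) ,
      trans (cong (λ y → double (y + 2 ^ j)) r+1≡2^j)
            (trans (cong double (sym (2^suc j))) (double≡2* (2 ^ suc j)))

odd-a⇔ : ∀ n → 1 ≤ n → (odd (a n) ≡ true) ⇔ (n ≡ 1 ⊎ ∃[ t ] (1 < t × n ≡ 2 ^ t))
odd-a⇔ (suc n) _ with parityView n
... | even-view zero    = mk⇔ (λ _ → inj₁ refl) (λ _ → refl)
... | even-view (suc k) = false⇔ (odd-a[3+2k] k) λ where
  (inj₂ (suc t , _ , n≡2^t)) → contradiction
    (trans (sym (odd-suc-double (suc k))) (trans (cong odd n≡2^t) (odd-* 2 (2 ^ t)))) λ ()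
... | odd-view zero     = false⇔ refl λ where
  (inj₂ (t , 1<t , 2≡2^t)) → <⇒≢ (^-monoʳ-< 2 (s≤s (s≤s z≤n)) 1<t) 2≡2^t
... | odd-view (suc i) with binaryDecomposition i
...   | j , r , r<2^j , i+1≡ = begin
  odd (a (double (suc (suc i)))) ≡ true                ≈⟨ ≡true-cong (odd-a[4+2i] i {j} i+1≡ r<2^j) ⟩
  odd (suc (suc (r + r)) C suc (r + 2 ^ j)) ≡ true     ≈⟨ odd-central⇔ j r r<2^j ⟩
  suc r ≡ 2 ^ j                                        ≈⟨ ⇔-sym (double-pow2⇔ j r r<2^j) ⟩
  (∃[ t ] (1 < t × double (suc r + 2 ^ j) ≡ 2 ^ t))    ≈⟨ powers ⟩
  (double (suc (suc i)) ≡ 1 ⊎ ∃[ t ] (1 < t × double (suc (suc i)) ≡ 2 ^ t)) ∎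
  where
    open SetoidReasoning (⇔-setoid 0ℓ)
    powers : (∃[ t ] (1 < t × double (suc r + 2 ^ j) ≡ 2 ^ t)) ⇔
             (double (suc (suc i)) ≡ 1 ⊎ ∃[ t ] (1 < t × double (suc (suc i)) ≡ 2 ^ t))
    powers = mk⇔ (λ (t , 1<t , e) → inj₂ (t , 1<t , trans (cong (double ∘ suc) i+1≡) e)) λ where
      (inj₂ (t , 1<t , e)) → t , 1<t , trans (cong (double ∘ suc) (sym i+1≡)) e

mainTheorem17 : (n : ℕ) → 1 ≤ n →
    (a n % 2 ≡ 1) ⇔ (n ≡ 1 ⊎ ∃[ t ] (1 < t × n ≡ 2 ^ t))
mainTheorem17 n 1≤n = ⇔-trans (%2≡1⇔odd (a n)) (odd-a⇔ n 1≤n)
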